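{- Let $G$ be a non-elementary tagged block graph. Then $\mu(G)=2$.
   Context: Graphs are simple and connected; $d$ is the shortest-path distance. A block graph is a graph obtained by starting with a complete graph $K_{n_1}$, $n_1\ge2$, and repeatedly (finitely many times, at least once) adding a complete graph $K_{n_i}$, $n_i\ge2$, identifying one of its vertices with one vertex of the graph built so far (equivalently, a finite connected graph whose blocks are all complete). It is non-elementary if it is neither a complete graph nor a path. It is tagged if there exist a maximal complete subgraph $K_r$ with $r\ge3$ and two vertices $u,v\in K_r$ with $\deg(u)=\deg(v)=r-1$. For a vertex $v$ and positive integer $m$, $S(v,m)=\{w: d(v,w)=m\}$. A vertex separator is a set of vertices whose removal disconnects $G$. For distinct $v,v'$, a common separating subset of their $m$-spheres is a set $S\subseteq S(v,m)\cap S(v',m)$ which is a vertex separator such that some component of $G\setminus S$ contains neither $v$ nor $v'$. $\mathcal{P}_m(G)$ is the set of ordered pairs of distinct vertices whose $m$-spheres have a common separating subset. For $(v,v')\in\mathcal{P}_m(G)$, $S_m(v,v')$ is the union of all such subsets, $C_m^j$ ($j\in J$) the components of $G\setminus S_m(v,v')$ containing neither $v$ nor $v'$, $\mu_m(v,v')=|\{w\in V(G)\setminus\bigcup_jC_m^j: d(v,w)\neq d(v',w)\}|$; $\mu_m(G)=\min_{\mathcal{P}_m(G)}\mu_m(v,v')$, $\mu(G)=\min_m\mu_m(G)$ (minimum over empty set $=+\infty$). -}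

module Defs where

open import Data.Nat using (ℕ; zero; suc; _+_; _≤_; _∸_)
open import Data.Bool using (Bool; true; false; not)
open import Data.Fin using (Fin; toℕ; splitAt; _≟_)
open import Data.Fin.Subset using (Subset; _∈_; _∉_; ∣_∣)
open import Data.Vec using (tabulate)
open import Data.Sum using (_⊎_; inj₁; inj₂)
open import Data.Product using (Σ; ∃; ∃-syntax; _×_; _,_)
open import Data.List using (List; length)
open import Data.List.Membership.Propositional using () renaming (_∈_ to _∈ₗ_)
open import Data.List.Relation.Unary.Unique.Propositional using (Unique)
open import Relation.Nullary using (¬_; does)
open import Relation.Binary.PropositionalEquality using (_≡_; _≢_)
open import Function.Bundles using (_↔_; Inverse; _⇔_)

Graph : ℕ → Set
Graph n = Fin n → Fin n → Bool

IsSimple : ∀ {n} → Graph n → Set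
IsSimple {n} G = (∀ i j → G i j ≡ G j i) × (∀ i → G i i ≡ false)

data Walk {n} (G : Graph n) : Fin n → Fin n → ℕ → Set where
  nil  : ∀ {u} → Walk G u u 0
  cons : ∀ {u w v k} → G u w ≡ true → Walk G w v k → Walk G u v (suc k)

Connected : ∀ {n} → Graph n → Set
Connected {n} G = ∀ (u v : Fin n) → ∃[ k ] Walk G u v k

Dist : ∀ {n} → Graph n → Fin n → Fin n → ℕ → Set
Dist G u v k = Walk G u v k × (∀ j → Walk G u v j → k ≤ j)

-- Reachability in G minus a removed vertex set (given as a predicate):
-- there is a walk from u to v all of whose vertices are not removed.
data Reach {n} (G : Graph n) (Removed : Fin n → Set) : Fin n → Fin n → Set where
  here : ∀ {u} → ¬ Removed u → Reach G Removed u u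
  step : ∀ {u w v} → ¬ Removed u → G u w ≡ true → Reach G Removed w v → Reach G Removed u v

HasCard : ∀ {n} → (Fin n → Set) → ℕ → Set
HasCard {n} P c = Σ (List (Fin n)) λ xs →
  Unique xs × (∀ w → (w ∈ₗ xs) ⇔ P w) × length xs ≡ c

degree : ∀ {n} → Graph n → Fin n → ℕ
degree G i = ∣ tabulate (G i) ∣

InSphere : ∀ {n} → Graph n → Fin n → ℕ → Fin n → Set
InSphere G v m w = Dist G v w m

VertexSeparator : ∀ {n} → Graph n → Subset n → Set
VertexSeparator {n} G S =
  Σ (Fin n) λ a → Σ (Fin n) λ b → a ∉ S × b ∉ S × ¬ Reach G (λ w → w ∈ S) a b

InOtherComponent : ∀ {n} → Graph n → (Fin n → Set) → Fin n → Fin n → Fin n → Set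
InOtherComponent G Removed v v' w =
  ¬ Removed w × ¬ Reach G Removed w v × ¬ Reach G Removed w v'

CommonSep : ∀ {n} → Graph n → ℕ → Fin n → Fin n → Subset n → Set
CommonSep {n} G m v v' S =
  (∀ w → w ∈ S → InSphere G v m w × InSphere G v' m w)
  × VertexSeparator G S
  × ∃[ w ] InOtherComponent G (λ x → x ∈ S) v v' w

InP : ∀ {n} → Graph n → ℕ → Fin n → Fin n → Set
InP G m v v' = v ≢ v' × ∃[ S ] CommonSep G m v v' S

InSm : ∀ {n} → Graph n → ℕ → Fin n → Fin n → Fin n → Set
InSm G m v v' w = ∃[ S ] (CommonSep G m v v' S × w ∈ S)

DistDiffers : ∀ {n} → Graph n → Fin n → Fin n → Fin n → Set
DistDiffers G v v' w = ∀ k k' → Dist G v w k → Dist G v' w k' → k ≢ k'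

MuIs : ∀ {n} → Graph n → ℕ → Fin n → Fin n → ℕ → Set
MuIs G m v v' c =
  HasCard (λ w → ¬ InOtherComponent G (InSm G m v v') v v' w × DistDiffers G v v' w) c

MuEq : ∀ {n} → Graph n → ℕ → Set
MuEq {n} G c =
  (Σ ℕ λ m → Σ (Fin n) λ v → Σ (Fin n) λ v' →
     1 ≤ m × InP G m v v' × MuIs G m v v' c)
  × (∀ m (v v' : Fin n) d → 1 ≤ m → InP G m v v' → MuIs G m v v' d → c ≤ d)

eqb : ∀ {n} → Fin n → Fin n → Bool
eqb i j = does (i ≟ j)

complete : (n : ℕ) → Graph n
complete n i j = not (eqb i j)

-- glue a complete graph K_{1+j} to G, identifying one of its vertices with x;
-- the j new vertices are the last j vertices.
glue : ∀ {n} → Graph n → Fin n → (j : ℕ) → Graph (n + j)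
glue {n} G x j a b with splitAt n a | splitAt n b
... | inj₁ i | inj₁ i' = G i i'
... | inj₂ p | inj₂ q  = not (eqb p q)
... | inj₁ i | inj₂ _  = eqb i x
... | inj₂ _ | inj₁ i  = eqb i x

-- Built n H s : H is obtained from some K_{n1} (n1 ≥ 2) by s gluing steps,
-- each gluing a K_{ni} with ni = 1 + j ≥ 2.
data Built : (n : ℕ) → Graph n → ℕ → Set where
  base : ∀ k → 2 ≤ k → Built k (complete k) 0
  add  : ∀ {n H s} → Built n H s → (x : Fin n) → (j : ℕ) → 1 ≤ j →
         Built (n + j) (glue H x j) (suc s)

Iso : ∀ {n m} → Graph n → Graph m → Set
Iso {n} {m} G H = Σ (Fin n ↔ Fin m) λ f →
  ∀ i j → G i j ≡ H (Inverse.to f i) (Inverse.to f j)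

BlockGraph : ∀ {n} → Graph n → Set
BlockGraph {n} G = Σ ℕ λ s → 1 ≤ s × Σ (Graph n) λ H → Built n H s × Iso G H

IsComplete : ∀ {n} → Graph n → Set
IsComplete {n} G = ∀ (i j : Fin n) → i ≢ j → G i j ≡ true

pathGraph : (n : ℕ) → Graph n
pathGraph n i j = does (((toℕ i ∸ toℕ j) + (toℕ j ∸ toℕ i)) Data.Nat.≟ 1)

IsPath : ∀ {n} → Graph n → Set
IsPath {n} G = Iso G (pathGraph n)

NonElementary : ∀ {n} → Graph n → Set
NonElementary G = ¬ IsComplete G × ¬ IsPath G

IsClique : ∀ {n} → Graph n → Subset n → Set
IsClique G K = ∀ i j → i ∈ K → j ∈ K → i ≢ j → G i j ≡ true

IsMaximalClique : ∀ {n} → Graph n → Subset n → Set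
IsMaximalClique G K = IsClique G K × (∀ w → w ∉ K → ¬ (∀ i → i ∈ K → G w i ≡ true))

Tagged : ∀ {n} → Graph n → Set
Tagged {n} G = Σ (Subset n) λ K → IsMaximalClique G K × 3 ≤ ∣ K ∣ ×
  Σ (Fin n) λ u → Σ (Fin n) λ v → u ≢ v × u ∈ K × v ∈ K ×
    degree G u ≡ ∣ K ∣ ∸ 1 × degree G v ≡ ∣ K ∣ ∸ 1

-- Every pair (v, v') admissible for μ contributes at least v and v' themselves to μ_m(v, v'),
-- so μ(G) ≥ 2. For the upper bound let u, v be the two tagged vertices of the clique K. Their
-- degree |K| − 1 forces all their neighbours into K, so S = K ∖ {u, v} lies in both 1-spheres
-- and separates {u, v} from the vertices outside K, which exist because G is not complete.
-- Every vertex other than u and v is then either in S, hence at distance 1 from both, or cut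
-- off by S; thus μ_1(u, v) = 2.
module Submission where

open import Defs
open import Data.Nat using (ℕ; zero; suc; _≤_; _∸_; z≤n; s≤s)
open import Data.Nat.Properties using (1+n≰n)
open import Data.Bool using (true; false)
open import Data.Fin using (Fin) renaming (_≟_ to _≟ᶠ_)
open import Data.Fin.Subset using (Subset; _∈_; _∉_; ∣_∣; _─_; _-_; ⁅_⁆; _⊆_; inside; outside)
open import Data.Fin.Subset.Properties
  using (_∈?_; p─⊥≡p; p─q⊆p; p⊂q⇒∣p∣<∣q∣; x∈p∧x≢y⇒x∈p-y; x∉⁅y⁆⇒x≢y)
open import Data.Fin.Properties using (¬∀⟶∃¬)
open import Data.Vec using (tabulate; _∷_; here; there)
open import Data.Vec.Properties using (lookup⇒[]=; lookup∘tabulate)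
open import Data.Sum using (_⊎_; inj₁; inj₂)
open import Data.Product using (∃; _×_; _,_; proj₁; proj₂)
open import Data.List using (List; length; _∷_; [])
open import Data.List.Membership.Propositional using () renaming (_∈_ to _∈ₗ_)
open import Data.List.Relation.Unary.Any using (here; there)
open import Data.List.Relation.Unary.All using () renaming (_∷_ to _∷ᵃ_; [] to []ᵃ)
open import Data.List.Relation.Unary.AllPairs using () renaming (_∷_ to _∷ᵖ_; [] to []ᵖ)
open import Data.Empty using (⊥-elim)
open import Relation.Nullary using (¬_; yes; no; contradiction)
open import Relation.Binary.PropositionalEquality using (_≡_; _≢_; refl; sym; trans; cong; subst)
open import Function using (_∘_)
open import Function.Bundles using (mk⇔; Equivalence)

x∈p─q⇒x∉q : ∀ {n} (p q : Subset n) {x} → x ∈ p ─ q → x ∉ q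
x∈p─q⇒x∉q (_ ∷ p) (inside  ∷ q) (there x∈) (there x∈q) = x∈p─q⇒x∉q p q x∈ x∈q
x∈p─q⇒x∉q (_ ∷ p) (outside ∷ q) (there x∈) (there x∈q) = x∈p─q⇒x∉q p q x∈ x∈q

x∈p-y⇒x∈p : ∀ {n} {p : Subset n} {x y} → x ∈ p - y → x ∈ p
x∈p-y⇒x∈p {p = p} {y = y} = p─q⊆p p ⁅ y ⁆

x∈p-y⇒x≢y : ∀ {n} {p : Subset n} {x y} → x ∈ p - y → x ≢ y
x∈p-y⇒x≢y {p = p} {y = y} x∈ = x∉⁅y⁆⇒x≢y (x∈p─q⇒x∉q p ⁅ y ⁆ x∈)

x∈p⇒∣p∣≡1+∣p-x∣ : ∀ {n} {p : Subset n} {x} → x ∈ p → ∣ p ∣ ≡ suc ∣ p - x ∣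
x∈p⇒∣p∣≡1+∣p-x∣ {p = _ ∷ p} here = cong (λ q → suc ∣ q ∣) (sym (p─⊥≡p p))
x∈p⇒∣p∣≡1+∣p-x∣ {p = inside  ∷ _} (there x∈) = cong suc (x∈p⇒∣p∣≡1+∣p-x∣ x∈)
x∈p⇒∣p∣≡1+∣p-x∣ {p = outside ∷ _} (there x∈) = x∈p⇒∣p∣≡1+∣p-x∣ x∈

tabulate⁺ : ∀ {n} (f : Fin n → _) {x} → f x ≡ true → x ∈ tabulate f
tabulate⁺ f {x} fx = lookup⇒[]= x (tabulate f) (trans (lookup∘tabulate f x) fx)

length≥2 : ∀ {A : Set} {a b : A} (xs : List A) → a ∈ₗ xs → b ∈ₗ xs → a ≢ b → 2 ≤ length xs
length≥2 (_ ∷ []) (here refl) (here refl) a≢b = contradiction refl a≢b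
length≥2 (_ ∷ _ ∷ _) _ _ _ = s≤s (s≤s z≤n)

Walk-0⇒≡ : ∀ {n} {G : Graph n} {a b} → Walk G a b 0 → a ≡ b
Walk-0⇒≡ nil = refl

Walk-1⇒adjacent : ∀ {n} {G : Graph n} {a b} → Walk G a b 1 → G a b ≡ true
Walk-1⇒adjacent (cons ab nil) = ab

Dist-refl⇒0 : ∀ {n} {G : Graph n} {a k} → Dist G a a k → k ≡ 0
Dist-refl⇒0 (_ , minimal) with minimal 0 nil
... | z≤n = refl

Dist-≡0⇒≡ : ∀ {n} {G : Graph n} {a b k} → Dist G a b k → k ≡ 0 → a ≡ b
Dist-≡0⇒≡ (walk , _) refl = Walk-0⇒≡ walk

adjacent⇒Dist-1 : ∀ {n} {G : Graph n} {a b} → G a b ≡ true → a ≢ b → Dist G a b 1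
adjacent⇒Dist-1 {G = G} {a} {b} ab a≢b = cons ab nil , minimal
  where
  minimal : ∀ j → Walk G a b j → 1 ≤ j
  minimal zero    walk = contradiction (Walk-0⇒≡ walk) a≢b
  minimal (suc _) _    = s≤s z≤n

Counted : ∀ {n} → Graph n → ℕ → Fin n → Fin n → Fin n → Set
Counted G m v v' w = ¬ InOtherComponent G (InSm G m v v') v v' w × DistDiffers G v v' w

module _ {n} (G : Graph n) (m : ℕ) {v v' : Fin n} (v≢v' : v ≢ v') where

  left-counted : Counted G m v v' v
  left-counted = (λ (v∉S , v↛v , _) → v↛v (here v∉S))
               , λ k k' dvv dv'v k≡k' →
                   v≢v' (sym (Dist-≡0⇒≡ dv'v (trans (sym k≡k') (Dist-refl⇒0 dvv))))

  right-counted : Counted G m v v' v'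
  right-counted = (λ (v'∉S , _ , v'↛v') → v'↛v' (here v'∉S))
                , λ k k' dvv' dv'v' k≡k' →
                    v≢v' (Dist-≡0⇒≡ dvv' (trans k≡k' (Dist-refl⇒0 dv'v')))

MuIs⇒2≤ : ∀ {n} (G : Graph n) m (v v' : Fin n) c → InP G m v v' → MuIs G m v v' c → 2 ≤ c
MuIs⇒2≤ G m v v' c (v≢v' , _) (xs , _ , counted⇔ , refl) =
  length≥2 xs (Equivalence.from (counted⇔ v)  (left-counted  G m v≢v'))
              (Equivalence.from (counted⇔ v') (right-counted G m v≢v')) v≢v'

∃∉clique : ∀ {n} (G : Graph n) {K} → IsClique G K → ¬ IsComplete G → ∃ λ z → z ∉ K
∃∉clique {n} G {K} clique incomplete =
  ¬∀⟶∃¬ n (_∈ K) (_∈? K) λ all∈K → incomplete λ i j → clique i j (all∈K i) (all∈K j)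

-- The clique K − a already accounts for the whole degree of a, so no neighbour lies outside K.
clique-degree⇒neighbours∈clique :
  ∀ {n} (G : Graph n) {K a} → IsClique G K → a ∈ K →
  degree G a ≡ ∣ K ∣ ∸ 1 → ∀ x → G a x ≡ true → x ∈ K
clique-degree⇒neighbours∈clique G {K} {a} clique a∈K deg≡ x ax with x ∈? K
... | yes x∈K = x∈K
... | no  x∉K = ⊥-elim (1+n≰n (subst (suc ∣ K - a ∣ ≤_) deg≡∣K-a∣ K-a<N[a]))
  where
  K-a⊆N[a] : K - a ⊆ tabulate (G a)
  K-a⊆N[a] {y} y∈ = tabulate⁺ (G a) (clique a y a∈K (x∈p-y⇒x∈p y∈) λ a≡y → x∈p-y⇒x≢y y∈ (sym a≡y))
  K-a<N[a] : suc ∣ K - a ∣ ≤ degree G a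
  K-a<N[a] = p⊂q⇒∣p∣<∣q∣ (K-a⊆N[a] , x , tabulate⁺ (G a) ax , λ x∈ → x∉K (x∈p-y⇒x∈p x∈))
  deg≡∣K-a∣ : degree G a ≡ ∣ K - a ∣
  deg≡∣K-a∣ = trans deg≡ (cong (_∸ 1) (x∈p⇒∣p∣≡1+∣p-x∣ a∈K))

module TwinsInClique {n} (G : Graph n) (simple : IsSimple G) {K : Subset n}
  (clique : IsClique G K) {u v : Fin n} (u≢v : u ≢ v) (u∈K : u ∈ K) (v∈K : v ∈ K)
  (N[u]⊆K : ∀ x → G u x ≡ true → x ∈ K) (N[v]⊆K : ∀ x → G v x ≡ true → x ∈ K)
  {z : Fin n} (z∉K : z ∉ K) where

  symmetric : ∀ i j → G i j ≡ G j i
  symmetric = proj₁ simple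

  loopless : ∀ i → G i i ≡ false
  loopless = proj₂ simple

  S : Subset n
  S = K - u - v

  ∈S⁺ : ∀ {w} → w ∈ K → w ≢ u → w ≢ v → w ∈ S
  ∈S⁺ w∈K w≢u w≢v = x∈p∧x≢y⇒x∈p-y (x∈p∧x≢y⇒x∈p-y w∈K w≢u) w≢v

  ∈S⁻ : ∀ {w} → w ∈ S → w ∈ K × w ≢ u × w ≢ v
  ∈S⁻ w∈S = x∈p-y⇒x∈p (x∈p-y⇒x∈p w∈S) , x∈p-y⇒x≢y (x∈p-y⇒x∈p w∈S) , x∈p-y⇒x≢y w∈S

  InPair : Fin n → Set
  InPair x = x ≡ u ⊎ x ≡ v

  z∉pair : ¬ InPair z
  z∉pair (inj₁ refl) = z∉K u∈K
  z∉pair (inj₂ refl) = z∉K v∈K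

  adjacent⇒≢ : ∀ {a b} → G a b ≡ true → a ≢ b
  adjacent⇒≢ {a} ab refl with trans (sym ab) (loopless a)
  ... | ()

  module _ {Removed : Fin n → Set} (S⊆Removed : ∀ {w} → w ∈ S → Removed w) where

    kept∈K⇒pair : ∀ {x} → ¬ Removed x → x ∈ K → InPair x
    kept∈K⇒pair {x} x-kept x∈K with x ≟ᶠ u | x ≟ᶠ v
    ... | yes x≡u | _       = inj₁ x≡u
    ... | no  _   | yes x≡v = inj₂ x≡v
    ... | no  x≢u | no  x≢v = contradiction (S⊆Removed (∈S⁺ x∈K x≢u x≢v)) x-kept

    -- A walk avoiding S cannot leave {u, v}: all neighbours of u and v lie in K.
    reach-pair⇒pair : ∀ {x y} → Reach G Removed x y → InPair y → InPair x
    reach-pair⇒pair (here _) y∈pair = y∈pair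
    reach-pair⇒pair {x} (step x-kept xw w↝y) y∈pair with reach-pair⇒pair w↝y y∈pair
    ... | inj₁ refl = kept∈K⇒pair x-kept (N[u]⊆K x (trans (symmetric u x) xw))
    ... | inj₂ refl = kept∈K⇒pair x-kept (N[v]⊆K x (trans (symmetric v x) xw))

  S-cuts-off-z : ∀ {y} → Reach G (_∈ S) z y → ¬ InPair y
  S-cuts-off-z z↝y y∈pair = z∉pair (reach-pair⇒pair (λ w∈S → w∈S) z↝y y∈pair)

  ∈S⇒spheres : ∀ {w} → w ∈ S → InSphere G u 1 w × InSphere G v 1 w
  ∈S⇒spheres w∈S =
    let w∈K , w≢u , w≢v = ∈S⁻ w∈S
    in adjacent⇒Dist-1 (clique _ _ u∈K w∈K (λ u≡w → w≢u (sym u≡w))) (λ u≡w → w≢u (sym u≡w))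
     , adjacent⇒Dist-1 (clique _ _ v∈K w∈K (λ v≡w → w≢v (sym v≡w))) (λ v≡w → w≢v (sym v≡w))

  z∉S : z ∉ S
  z∉S z∈S = z∉K (proj₁ (∈S⁻ z∈S))

  commonSep : CommonSep G 1 u v S
  commonSep = (λ _ → ∈S⇒spheres)
            , (z , u , z∉S , (λ u∈S → proj₁ (proj₂ (∈S⁻ u∈S)) refl)
              , λ z↝u → S-cuts-off-z z↝u (inj₁ refl))
            , z , z∉S , (λ z↝u → S-cuts-off-z z↝u (inj₁ refl))
              , λ z↝v → S-cuts-off-z z↝v (inj₂ refl)

  InSm⇒∈S : ∀ {w} → InSm G 1 u v w → w ∈ S
  InSm⇒∈S {w} (S' , (S'⊆spheres , _) , w∈S') =
    let (u~w , _) , (v~w , _) = S'⊆spheres w w∈S'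
        uw = Walk-1⇒adjacent u~w
        vw = Walk-1⇒adjacent v~w
    in ∈S⁺ (N[u]⊆K w uw) (λ w≡u → adjacent⇒≢ uw (sym w≡u)) (λ w≡v → adjacent⇒≢ vw (sym w≡v))

  counted⇒pair : ∀ w → Counted G 1 u v w → InPair w
  counted⇒pair w (not-cut-off , differs) with w ≟ᶠ u | w ≟ᶠ v | w ∈? K
  ... | yes w≡u | _       | _       = inj₁ w≡u
  ... | no  _   | yes w≡v | _       = inj₂ w≡v
  ... | no  w≢u | no  w≢v | yes w∈K =
    let du , dv = ∈S⇒spheres (∈S⁺ w∈K w≢u w≢v) in contradiction refl (differs 1 1 du dv)
  ... | no  w≢u | no  w≢v | no  w∉K =
    contradiction ( (λ w∈Sm → w∉K (proj₁ (∈S⁻ (InSm⇒∈S w∈Sm))))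
                  , (λ w↝u → ¬pair (reach-pair⇒pair S⊆Sm w↝u (inj₁ refl)))
                  , (λ w↝v → ¬pair (reach-pair⇒pair S⊆Sm w↝v (inj₂ refl))) )
                  not-cut-off
    where
    S⊆Sm : ∀ {x} → x ∈ S → InSm G 1 u v x
    S⊆Sm x∈S = S , commonSep , x∈S
    ¬pair : ¬ InPair w
    ¬pair (inj₁ w≡u) = w≢u w≡u
    ¬pair (inj₂ w≡v) = w≢v w≡v

  μ₁≡2 : MuIs G 1 u v 2
  μ₁≡2 = u ∷ v ∷ [] , (u≢v ∷ᵃ []ᵃ) ∷ᵖ []ᵃ ∷ᵖ []ᵖ
       , (λ w → mk⇔ pair⇒counted (pair⇒∈ₗ ∘ counted⇒pair w)) , refl
    where
    pair⇒counted : ∀ {w} → w ∈ₗ u ∷ v ∷ [] → Counted G 1 u v w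
    pair⇒counted (here refl)         = left-counted  G 1 u≢v
    pair⇒counted (there (here refl)) = right-counted G 1 u≢v
    pair⇒∈ₗ : ∀ {w} → InPair w → w ∈ₗ u ∷ v ∷ []
    pair⇒∈ₗ (inj₁ refl) = here refl
    pair⇒∈ₗ (inj₂ refl) = there (here refl)

proposition3p16 : ∀ {n} (G : Graph n) → IsSimple G → Connected G →
                    BlockGraph G → NonElementary G → Tagged G → MuEq G 2
proposition3p16 G simple _ _ (incomplete , _)
  (K , (clique , _) , _ , u , v , u≢v , u∈K , v∈K , deg[u] , deg[v]) =
  (1 , u , v , s≤s z≤n , (u≢v , S , commonSep) , μ₁≡2) , λ m x x' c _ → MuIs⇒2≤ G m x x' c
  where
  open TwinsInClique G simple clique u≢v u∈K v∈K
    (clique-degree⇒neighbours∈clique G clique u∈K deg[u])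
    (clique-degree⇒neighbours∈clique G clique v∈K deg[v])
    (proj₂ (∃∉clique G clique incomplete))
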